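{- Let $G$ be a 3-uniform hypergraph with vertex set $V$ and $m$ edges. If there is a set $A\subset V$ with $d_2(A)=0$ and $d(A)\ge\frac{3}{5}m$, then there exists a partition of $V$ into three good sets. In particular, if $\Delta(G)\ge\frac{3}{5}m$ then such a partition exists.
   Context: A 3-uniform hypergraph has a finite vertex set $V$ and $m$ edges that are distinct 3-element subsets of $V$. For $A\subseteq V$, $d(A)$ is the number of edges meeting $A$ (having nonempty intersection with $A$), and $d_2(A)$ is the number of edges meeting $A$ in at least 2 vertices. A set is good if it meets at least $\frac{3}{5}m$ edges. $\Delta(G)$ is the maximum degree, the degree of a vertex being the number of edges containing it. -}

module Defs where

open import Data.Nat using (ℕ; _+_; _*_; _≤_; _≤?_; _⊔_)
open import Data.Bool using (Bool; true; false; if_then_else_)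
open import Data.Fin using (Fin; _≟_) renaming (_<_ to _<ᶠ_)
open import Data.Fin.Subset using (Subset)
open import Data.List using (List; filter; length; map; foldr; allFin)
open import Data.List.Relation.Unary.Unique.Propositional using (Unique)
open import Data.Vec using (lookup; tabulate)
open import Relation.Nullary.Decidable using (⌊_⌋)

-- A 3-element subset {a,b,c} of Fin n, in canonical form a < b < c.
record Edge (n : ℕ) : Set where
  constructor edge
  field
    v₁ v₂ v₃ : Fin n
    v₁<v₂ : v₁ <ᶠ v₂
    v₂<v₃ : v₂ <ᶠ v₃
open Edge public

record Hypergraph3 (n : ℕ) : Set where
  field
    edges    : List (Edge n)
    distinct : Unique edges
open Hypergraph3 public

m : ∀ {n} → Hypergraph3 n → ℕ
m G = length (edges G)

indic : ∀ {n} → Subset n → Fin n → ℕ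
indic A v = if lookup A v then 1 else 0

meetSize : ∀ {n} → Edge n → Subset n → ℕ
meetSize e A = indic A (v₁ e) + indic A (v₂ e) + indic A (v₃ e)

d : ∀ {n} → Hypergraph3 n → Subset n → ℕ
d G A = length (filter (λ e → 1 ≤? meetSize e A) (edges G))

d₂ : ∀ {n} → Hypergraph3 n → Subset n → ℕ
d₂ G A = length (filter (λ e → 2 ≤? meetSize e A) (edges G))

-- A is good iff d(A) ≥ (3/5) m, i.e. 5 d(A) ≥ 3 m
Good : ∀ {n} → Hypergraph3 n → Subset n → Set
Good G A = 3 * m G ≤ 5 * d G A

contains : ∀ {n} → Edge n → Fin n → Bool
contains e v = ⌊ v ≟ v₁ e ⌋ Data.Bool.∨ ⌊ v ≟ v₂ e ⌋ Data.Bool.∨ ⌊ v ≟ v₃ e ⌋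
  where import Data.Bool

deg : ∀ {n} → Hypergraph3 n → Fin n → ℕ
deg G v = length (filter (λ e → Data.Bool._≟_ (contains e v) true) (edges G))
  where import Data.Bool

-- maximum degree Δ(G) (0 for the empty vertex set)
Δ : ∀ {n} → Hypergraph3 n → ℕ
Δ {n} G = foldr _⊔_ 0 (map (deg G) (allFin n))

-- A partition of V into three (labelled) parts, given by a map V → Fin 3;
-- part f i is the i-th part.
part : ∀ {n} → (Fin n → Fin 3) → Fin 3 → Subset n
part f i = tabulate (λ v → ⌊ f v ≟ i ⌋)

HasGoodTripartition : ∀ {n} → Hypergraph3 n → Set
HasGoodTripartition {n} G = Data.Product.Σ (Fin n → Fin 3) (λ f → (i : Fin 3) → Good G (part f i))
  where import Data.Product

-- Label the vertices of A by 0 and split V ∖ A into parts 1 and 2 so that no single move of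
-- a vertex between parts 1 and 2 lowers the number of pairs (e, j), j ∈ {1, 2}, with the
-- edge e missing part j. Since every edge has at most one vertex in A, an edge missing part 2
-- has at least two vertices in part 1. Moving a vertex v from part 1 to part 2 therefore
-- repairs every edge through v that misses part 2, and breaks only the edges in which v is the
-- sole vertex of part 1. Summing this trade-off over part 1, the M edges missing part 2 are
-- counted at least twice on one side and the other m − M edges at most once on the other, so
-- 3M ≤ m and part 2 meets at least 2m/3 edges; symmetrically for part 1. A vertex of maximum
-- degree, as a singleton, is such a set A.
module Submission where

open import Defs
open import Data.Nat using (ℕ; _*_; _≤_)
open import Data.Fin.Subset using (Subset)
open import Data.Product using (_×_)
open import Relation.Binary.PropositionalEquality using (_≡_)

open import Data.Nat.Properties
  using ( +-comm; +-assoc; +-identityʳ; *-identityˡ; *-distribˡ-+; *-distribʳ-+; 0∸n≡0; ⊔-sel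
        ; m+n≡0⇒m≡0; m+n≡0⇒n≡0; n≤0⇒n≡0; ≤-refl; ≤-trans; ≤-pred; ≮⇒≥; ≰⇒>; ≤⇒≯; m≤n+m
        ; +-mono-≤; +-monoˡ-≤; +-monoʳ-≤; *-monoʳ-≤; +-cancelˡ-≤; +-cancelʳ-≤; module ≤-Reasoning
        ; +-0-commutativeMonoid; +-commutativeSemigroup; +-*-semiring )
open import Algebra.Properties.CommutativeMonoid.Sum +-0-commutativeMonoid
  using (sum; sum-syntax; sum-cong-≗; sum-replicate-zero; ∑-distrib-+; ∑-comm)
open import Algebra.Properties.CommutativeSemigroup +-commutativeSemigroup
  using (xy∙z≈xz∙y; x∙yz≈xz∙y)
open import Algebra.Properties.Semiring.Sum +-*-semiring using (*-distribˡ-sum)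
open import Data.Bool using (Bool; true; false; if_then_else_) renaming (_≟_ to _≟ᵇ_)
open import Data.Empty using (⊥-elim)
open import Data.Fin using (Fin; zero; suc; _≟_)
open import Data.Fin.Patterns using (0F; 1F; 2F)
open import Data.Fin.Properties using (all?; any?; <⇒≢; <-trans)
open import Data.Fin.Subset using (⁅_⁆)
open import Data.List using (List; []; _∷_; length; filter; map; foldr; lookup; allFin)
open import Data.List.Properties using (filter-none)
open import Data.List.Relation.Unary.All using (universal)
open import Data.Nat using (zero; suc; _+_; _∸_; _≤?_; _<?_; _⊔_; z≤n)
open import Data.Nat.Tactic.RingSolver using (solve-∀)
open import Data.Product using (∃; _,_)
open import Data.Sum using (_⊎_; inj₁; inj₂)
open import Data.Vec using () renaming (lookup to _!_)
open import Data.Vec.Functional using (updateAt)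
open import Data.Vec.Functional.Properties using (updateAt-updates; updateAt-minimal)
open import Data.Vec.Properties using (lookup∘tabulate; tabulate∘lookup; tabulate-cong; lookup-replicate)
open import Function using (_∘_)
open import Relation.Binary.PropositionalEquality
  using (refl; sym; trans; cong; cong₂; subst; subst₂; _≢_; ≢-sym; module ≡-Reasoning)
open import Relation.Nullary using (Dec; ¬_; ¬?; does; yes; no)
open import Relation.Nullary.Decidable using (⌊_⌋; ⌊⌋-map′; from-yes; _→-dec_)
open import Relation.Unary using (Pred; Decidable)

bit : Bool → ℕ
bit b = if b then 1 else 0

cong₃ : ∀ {A B C D : Set} (g : A → B → C → D) {x x′ y y′ z z′} →
        x ≡ x′ → y ≡ y′ → z ≡ z′ → g x y z ≡ g x′ y′ z′
cong₃ g refl refl refl = refl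

∑-mono-≤ : ∀ {n} {f g : Fin n → ℕ} → (∀ i → f i ≤ g i) → ∑[ i < n ] f i ≤ ∑[ i < n ] g i
∑-mono-≤ {zero}  f≤g = z≤n
∑-mono-≤ {suc n} f≤g = +-mono-≤ (f≤g zero) (∑-mono-≤ (f≤g ∘ suc))

∑≡0⇒≡0 : ∀ {n} (f : Fin n → ℕ) → ∑[ i < n ] f i ≡ 0 → ∀ i → f i ≡ 0
∑≡0⇒≡0 f ∑≡0 zero    = m+n≡0⇒m≡0 (f zero) ∑≡0
∑≡0⇒≡0 f ∑≡0 (suc i) = ∑≡0⇒≡0 (f ∘ suc) (m+n≡0⇒n≡0 (f zero) ∑≡0) i

∑-one : ∀ n → ∑[ i < n ] 1 ≡ n
∑-one zero    = refl
∑-one (suc n) = cong suc (∑-one n)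

∑-pick : ∀ {n} (a : Fin n) (f : Fin n → ℕ) → ∑[ u < n ] (bit ⌊ u ≟ a ⌋ * f u) ≡ f a
∑-pick {suc n} zero    f =
  trans (cong₂ _+_ (*-identityˡ (f zero)) (sum-replicate-zero n)) (+-identityʳ (f zero))
∑-pick {suc n} (suc a) f = cong (0 +_) (trans (sum-cong-≗ drop-suc) (∑-pick a (f ∘ suc)))
  where
    -- ⌊_⌋ does not compute through the map′ in the definition of suc u ≟ suc a.
    drop-suc : ∀ u → bit ⌊ suc u ≟ suc a ⌋ * f (suc u) ≡ bit ⌊ u ≟ a ⌋ * f (suc u)
    drop-suc u = cong (λ b → bit b * f (suc u)) (⌊⌋-map′ _ _ (u ≟ a))

∑-weighted-comm : ∀ {m n} (w : Fin n → ℕ) (h : Fin n → Fin m → ℕ) →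
                  ∑[ u < n ] (w u * ∑[ k < m ] h u k) ≡ ∑[ k < m ] ∑[ u < n ] (w u * h u k)
∑-weighted-comm w h = trans (sum-cong-≗ (λ u → *-distribˡ-sum (w u) (h u))) (∑-comm (λ u k → w u * h u k))

length-filter≡∑ : ∀ {p} {A : Set} {P : Pred A p} (P? : Decidable P) (xs : List A) →
                  length (filter P? xs) ≡ ∑[ k < length xs ] bit (does (P? (lookup xs k)))
length-filter≡∑ P? []       = refl
length-filter≡∑ P? (x ∷ xs) with does (P? x)
... | true  = cong suc (length-filter≡∑ P? xs)
... | false = length-filter≡∑ P? xs

foldr-⊔-sel : ∀ {X : Set} (g : X → ℕ) (xs : List X) →
              foldr _⊔_ 0 (map g xs) ≡ 0 ⊎ ∃ λ x → foldr _⊔_ 0 (map g xs) ≡ g x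
foldr-⊔-sel g []       = inj₁ refl
foldr-⊔-sel g (x ∷ xs) with ⊔-sel (g x) (foldr _⊔_ 0 (map g xs)) | foldr-⊔-sel g xs
... | inj₁ max≡gx | _                = inj₂ (x , max≡gx)
... | inj₂ max≡tl | inj₁ tl≡0        = inj₁ (trans max≡tl tl≡0)
... | inj₂ max≡tl | inj₂ (y , tl≡gy) = inj₂ (y , trans max≡tl tl≡gy)

module LocalMinimum {X : Set} {k : ℕ} (Φ : X → ℕ) (move : Fin k → X → X) where

  IsLocalMin : X → Set
  IsLocalMin x = ∀ i → Φ x ≤ Φ (move i x)

  ∃-local-min : (P : X → Set) → (∀ i {x} → P x → P (move i x)) →
                ∀ {x} → P x → ∃ λ y → P y × IsLocalMin y
  ∃-local-min P move-pres = descend (Φ _) ≤-refl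
    where
      descend : ∀ bound {x} → Φ x ≤ bound → P x → ∃ λ y → P y × IsLocalMin y
      descend zero {x} Φx≤0 Px = x , Px , λ i → ≤-trans Φx≤0 z≤n
      descend (suc bound) {x} Φx≤bound Px with any? (λ i → Φ (move i x) <? Φ x)
      ... | no ¬descent = x , Px , λ i → ≮⇒≥ (λ Φmx<Φx → ¬descent (i , Φmx<Φx))
      ... | yes (i , Φmx<Φx) = descend bound (≤-pred (≤-trans Φmx<Φx Φx≤bound)) (move-pres i Px)

open LocalMinimum

v₁≢v₂ : ∀ {n} (e : Edge n) → v₁ e ≢ v₂ e
v₁≢v₂ e = <⇒≢ (v₁<v₂ e)

v₂≢v₃ : ∀ {n} (e : Edge n) → v₂ e ≢ v₃ e
v₂≢v₃ e = <⇒≢ (v₂<v₃ e)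

v₁≢v₃ : ∀ {n} (e : Edge n) → v₁ e ≢ v₃ e
v₁≢v₃ e = <⇒≢ (<-trans (v₁<v₂ e) (v₂<v₃ e))

bit-contains : ∀ {n} (e : Edge n) u →
               bit (contains e u) ≡ bit ⌊ u ≟ v₁ e ⌋ + bit ⌊ u ≟ v₂ e ⌋ + bit ⌊ u ≟ v₃ e ⌋
bit-contains e u with u ≟ v₁ e | u ≟ v₂ e | u ≟ v₃ e
... | yes refl | yes u≡v₂ | _        = ⊥-elim (v₁≢v₂ e u≡v₂)
... | yes refl | no  _    | yes u≡v₃ = ⊥-elim (v₁≢v₃ e u≡v₃)
... | no  _    | yes refl | yes u≡v₃ = ⊥-elim (v₂≢v₃ e u≡v₃)
... | yes _    | no  _    | no  _    = refl
... | no  _    | yes _    | no  _    = refl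
... | no  _    | no  _    | yes _    = refl
... | no  _    | no  _    | no  _    = refl

∑-on-edge : ∀ {n} (e : Edge n) (f : Fin n → ℕ) →
            ∑[ u < n ] (bit (contains e u) * f u) ≡ f (v₁ e) + f (v₂ e) + f (v₃ e)
∑-on-edge {n} e f = begin
  ∑[ u < n ] (bit (contains e u) * f u)                       ≡⟨ sum-cong-≗ split ⟩
  ∑[ u < n ] (pick (v₁ e) u + pick (v₂ e) u + pick (v₃ e) u)  ≡⟨ ∑-distrib-+ _ (pick (v₃ e)) ⟩
  ∑[ u < n ] (pick (v₁ e) u + pick (v₂ e) u) + sum (pick (v₃ e))
    ≡⟨ cong (_+ sum (pick (v₃ e))) (∑-distrib-+ (pick (v₁ e)) (pick (v₂ e))) ⟩
  sum (pick (v₁ e)) + sum (pick (v₂ e)) + sum (pick (v₃ e))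
    ≡⟨ cong₃ (λ x y z → x + y + z) (∑-pick (v₁ e) f) (∑-pick (v₂ e) f) (∑-pick (v₃ e) f) ⟩
  f (v₁ e) + f (v₂ e) + f (v₃ e)                              ∎
  where
    open ≡-Reasoning
    pick : Fin n → Fin n → ℕ
    pick a u = bit ⌊ u ≟ a ⌋ * f u
    split : ∀ u → bit (contains e u) * f u ≡ pick (v₁ e) u + pick (v₂ e) u + pick (v₃ e) u
    split u = trans (cong (_* f u) (bit-contains e u))
                    (trans (*-distribʳ-+ (f u) (b₁ + b₂) b₃) (cong (_+ pick (v₃ e) u) (*-distribʳ-+ (f u) b₁ b₂)))
      where
        b₁ b₂ b₃ : ℕ
        b₁ = bit ⌊ u ≟ v₁ e ⌋
        b₂ = bit ⌊ u ≟ v₂ e ⌋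
        b₃ = bit ⌊ u ≟ v₃ e ⌋

∑-differ-on-edge : ∀ {n} (e : Edge n) (P Q : Fin n → ℕ) → (∀ u → contains e u ≡ false → P u ≡ Q u) →
                   ∑[ u < n ] P u + (Q (v₁ e) + Q (v₂ e) + Q (v₃ e))
                     ≡ ∑[ u < n ] Q u + (P (v₁ e) + P (v₂ e) + P (v₃ e))
∑-differ-on-edge {n} e P Q agree = begin
  sum P + (Q (v₁ e) + Q (v₂ e) + Q (v₃ e))  ≡⟨ cong (sum P +_) (∑-on-edge e Q) ⟨
  sum P + sum (restrict Q)                  ≡⟨ ∑-distrib-+ P (restrict Q) ⟨
  ∑[ u < n ] (P u + restrict Q u)           ≡⟨ sum-cong-≗ swap ⟩
  ∑[ u < n ] (Q u + restrict P u)           ≡⟨ ∑-distrib-+ Q (restrict P) ⟩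
  sum Q + sum (restrict P)                  ≡⟨ cong (sum Q +_) (∑-on-edge e P) ⟩
  sum Q + (P (v₁ e) + P (v₂ e) + P (v₃ e))  ∎
  where
    open ≡-Reasoning
    restrict : (Fin n → ℕ) → Fin n → ℕ
    restrict f u = bit (contains e u) * f u
    swap : ∀ u → P u + restrict Q u ≡ Q u + restrict P u
    swap u with contains e u in u∉e
    ... | true  = trans (cong₂ _+_ (sym (*-identityˡ (P u))) (*-identityˡ (Q u))) (+-comm _ (Q u))
    ... | false = cong (_+ 0) (agree u u∉e)

Labelling : ℕ → Set
Labelling n = Fin n → Fin 3

swap₁₂ : Fin 3 → Fin 3
swap₁₂ 0F = 0F
swap₁₂ 1F = 2F
swap₁₂ 2F = 1F

swapAt : ∀ {n} → Fin n → Labelling n → Labelling n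
swapAt v f = updateAt f v swap₁₂

onEdge : ∀ {n} {A : Set} → (Fin 3 → Fin 3 → Fin 3 → A) → Labelling n → Edge n → A
onEdge g f e = g (f (v₁ e)) (f (v₂ e)) (f (v₃ e))

count : Fin 3 → Fin 3 → Fin 3 → Fin 3 → ℕ
count i x y z = bit ⌊ x ≟ i ⌋ + bit ⌊ y ≟ i ⌋ + bit ⌊ z ≟ i ⌋

defect : Fin 3 → Fin 3 → Fin 3 → ℕ
defect x y z = (1 ∸ count 1F x y z) + (1 ∸ count 2F x y z)

afterSwaps : Fin 3 → Fin 3 → Fin 3 → Fin 3 → ℕ
afterSwaps i x y z =
  bit ⌊ x ≟ i ⌋ * defect (swap₁₂ x) y z + bit ⌊ y ≟ i ⌋ * defect x (swap₁₂ y) z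
    + bit ⌊ z ≟ i ⌋ * defect x y (swap₁₂ z)

beforeSwaps : Fin 3 → Fin 3 → Fin 3 → Fin 3 → ℕ
beforeSwaps i x y z =
  bit ⌊ x ≟ i ⌋ * defect x y z + bit ⌊ y ≟ i ⌋ * defect x y z + bit ⌊ z ≟ i ⌋ * defect x y z

-- An edge missing part swap₁₂ i has at least two vertices labelled i,
-- and swapping any of them removes its whole defect 1; otherwise its defect is 0, and a swap
-- raises it (to 1) only when the swapped vertex is the edge's sole vertex labelled i.
swap-bound : ∀ i x y z → i ≢ 0F → count 0F x y z ≤ 1 →
             afterSwaps i x y z + 3 * (1 ∸ count (swap₁₂ i) x y z) ≤ beforeSwaps i x y z + 1
swap-bound = from-yes (all? λ i → all? λ x → all? λ y → all? λ z →
  ¬? (i ≟ 0F) →-dec (count 0F x y z ≤? 1 →-dec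
    (afterSwaps i x y z + 3 * (1 ∸ count (swap₁₂ i) x y z) ≤? beforeSwaps i x y z + 1)))

indic-part : ∀ {n} (f : Labelling n) i v → indic (part f i) v ≡ bit ⌊ f v ≟ i ⌋
indic-part f i v = cong bit (lookup∘tabulate (λ u → ⌊ f u ≟ i ⌋) v)

meetSize-part : ∀ {n} (f : Labelling n) i (e : Edge n) → meetSize e (part f i) ≡ onEdge (count i) f e
meetSize-part f i e =
  cong₃ (λ x y z → x + y + z) (indic-part f i (v₁ e)) (indic-part f i (v₂ e)) (indic-part f i (v₃ e))

swapAt-off-edge : ∀ {n} {A : Set} (g : Fin 3 → Fin 3 → Fin 3 → A) (f : Labelling n) (e : Edge n) u →
                  contains e u ≡ false → onEdge g (swapAt u f) e ≡ onEdge g f e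
swapAt-off-edge g f e u u∉e with u ≟ v₁ e | u ≟ v₂ e | u ≟ v₃ e
swapAt-off-edge g f e u () | yes _ | _     | _
swapAt-off-edge g f e u () | no _  | yes _ | _
swapAt-off-edge g f e u () | no _  | no _  | yes _
... | no u≢v₁ | no u≢v₂ | no u≢v₃ =
  cong₃ g (updateAt-minimal _ u f (≢-sym u≢v₁)) (updateAt-minimal _ u f (≢-sym u≢v₂))
          (updateAt-minimal _ u f (≢-sym u≢v₃))

swapAt-v₁ : ∀ {n} {A : Set} (g : Fin 3 → Fin 3 → Fin 3 → A) (f : Labelling n) (e : Edge n) →
            onEdge g (swapAt (v₁ e) f) e ≡ g (swap₁₂ (f (v₁ e))) (f (v₂ e)) (f (v₃ e))
swapAt-v₁ g f e = cong₃ g (updateAt-updates (v₁ e) f)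
  (updateAt-minimal (v₂ e) (v₁ e) f (≢-sym (v₁≢v₂ e))) (updateAt-minimal (v₃ e) (v₁ e) f (≢-sym (v₁≢v₃ e)))

swapAt-v₂ : ∀ {n} {A : Set} (g : Fin 3 → Fin 3 → Fin 3 → A) (f : Labelling n) (e : Edge n) →
            onEdge g (swapAt (v₂ e) f) e ≡ g (f (v₁ e)) (swap₁₂ (f (v₂ e))) (f (v₃ e))
swapAt-v₂ g f e = cong₃ g (updateAt-minimal (v₁ e) (v₂ e) f (v₁≢v₂ e))
  (updateAt-updates (v₂ e) f) (updateAt-minimal (v₃ e) (v₂ e) f (≢-sym (v₂≢v₃ e)))

swapAt-v₃ : ∀ {n} {A : Set} (g : Fin 3 → Fin 3 → Fin 3 → A) (f : Labelling n) (e : Edge n) →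
            onEdge g (swapAt (v₃ e) f) e ≡ g (f (v₁ e)) (f (v₂ e)) (swap₁₂ (f (v₃ e)))
swapAt-v₃ g f e = cong₃ g (updateAt-minimal (v₁ e) (v₃ e) f (v₁≢v₃ e))
  (updateAt-minimal (v₂ e) (v₃ e) f (v₂≢v₃ e)) (updateAt-updates (v₃ e) f)

swap-edge-bound : ∀ {n} i → i ≢ 0F → (f : Labelling n) (e : Edge n) → meetSize e (part f 0F) ≤ 1 →
  ∑[ u < n ] (bit ⌊ f u ≟ i ⌋ * onEdge defect (swapAt u f) e) + 3 * (1 ∸ meetSize e (part f (swap₁₂ i)))
    ≤ ∑[ u < n ] (bit ⌊ f u ≟ i ⌋ * onEdge defect f e) + 1
swap-edge-bound {n} i i≢0 f e e∩part₀≤1 = +-cancelʳ-≤ (onVertices Q) _ _ (begin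
  sum P + missing + onVertices Q    ≡⟨ xy∙z≈xz∙y (sum P) missing (onVertices Q) ⟩
  sum P + onVertices Q + missing    ≡⟨ cong (_+ missing) (∑-differ-on-edge e P Q agree) ⟩
  sum Q + onVertices P + missing    ≡⟨ +-assoc (sum Q) (onVertices P) missing ⟩
  sum Q + (onVertices P + missing)  ≡⟨ cong (λ s → sum Q + s) (cong₂ _+_ P-on-edge missing-count) ⟩
  sum Q + (afterSwaps i x y z + 3 * (1 ∸ count (swap₁₂ i) x y z))
    ≤⟨ +-monoʳ-≤ (sum Q) (swap-bound i x y z i≢0 (subst (_≤ 1) (meetSize-part f 0F e) e∩part₀≤1)) ⟩
  sum Q + (onVertices Q + 1)        ≡⟨ x∙yz≈xz∙y (sum Q) (onVertices Q) 1 ⟩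
  sum Q + 1 + onVertices Q          ∎)
  where
    open ≤-Reasoning
    x y z : Fin 3
    x = f (v₁ e)
    y = f (v₂ e)
    z = f (v₃ e)
    P Q : Fin n → ℕ
    P u = bit ⌊ f u ≟ i ⌋ * onEdge defect (swapAt u f) e
    Q u = bit ⌊ f u ≟ i ⌋ * onEdge defect f e
    onVertices : (Fin n → ℕ) → ℕ
    onVertices h = h (v₁ e) + h (v₂ e) + h (v₃ e)
    missing : ℕ
    missing = 3 * (1 ∸ meetSize e (part f (swap₁₂ i)))
    agree : ∀ u → contains e u ≡ false → P u ≡ Q u
    agree u u∉e = cong (bit ⌊ f u ≟ i ⌋ *_) (swapAt-off-edge defect f e u u∉e)
    P-on-edge : onVertices P ≡ afterSwaps i x y z
    P-on-edge = cong₃ (λ a b c → a + b + c) (cong (bit ⌊ x ≟ i ⌋ *_) (swapAt-v₁ defect f e))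
      (cong (bit ⌊ y ≟ i ⌋ *_) (swapAt-v₂ defect f e)) (cong (bit ⌊ z ≟ i ⌋ *_) (swapAt-v₃ defect f e))
    missing-count : missing ≡ 3 * (1 ∸ count (swap₁₂ i) x y z)
    missing-count = cong (λ k → 3 * (1 ∸ k)) (meetSize-part f (swap₁₂ i) e)

edgeAt : ∀ {n} (G : Hypergraph3 n) → Fin (m G) → Edge n
edgeAt G = lookup (edges G)

totalDefect : ∀ {n} → Hypergraph3 n → Labelling n → ℕ
totalDefect G f = ∑[ k < m G ] onEdge defect f (edgeAt G k)

missingEdges : ∀ {n} → Hypergraph3 n → Subset n → ℕ
missingEdges G P = ∑[ k < m G ] (1 ∸ meetSize (edgeAt G k) P)

bit-does≡0⇒¬ : ∀ {A : Set} (a? : Dec A) → bit (does a?) ≡ 0 → ¬ A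
bit-does≡0⇒¬ (yes _) ()
bit-does≡0⇒¬ (no ¬a) _ = ¬a

d₂≡0⇒meetSize≤1 : ∀ {n} (G : Hypergraph3 n) P → d₂ G P ≡ 0 → ∀ k → meetSize (edgeAt G k) P ≤ 1
d₂≡0⇒meetSize≤1 G P d₂≡0 k = ≤-pred (≰⇒> (bit-does≡0⇒¬ (2 ≤? meetSize (edgeAt G k) P)
  (∑≡0⇒≡0 _ (trans (sym (length-filter≡∑ _ (edges G))) d₂≡0) k)))

local-min⇒3*missing≤m : ∀ {n} (G : Hypergraph3 n) (f : Labelling n) i → i ≢ 0F → d₂ G (part f 0F) ≡ 0 →
              IsLocalMin (totalDefect G) swapAt f → 3 * missingEdges G (part f (swap₁₂ i)) ≤ m G
local-min⇒3*missing≤m {n} G f i i≢0 d₂≡0 minimal = +-cancelˡ-≤ after _ _ (begin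
  after + 3 * missingEdges G (part f (swap₁₂ i))  ≡⟨ cong (after +_) (*-distribˡ-sum 3 missing) ⟩
  after + ∑[ k < m G ] (3 * missing k)            ≡⟨ ∑-distrib-+ afterₖ (λ k → 3 * missing k) ⟨
  ∑[ k < m G ] (afterₖ k + 3 * missing k)
    ≤⟨ ∑-mono-≤ (λ k → swap-edge-bound i i≢0 f (edgeAt G k) (d₂≡0⇒meetSize≤1 G (part f 0F) d₂≡0 k)) ⟩
  ∑[ k < m G ] (beforeₖ k + 1)                    ≡⟨ ∑-distrib-+ beforeₖ (λ _ → 1) ⟩
  before + ∑[ k < m G ] 1                         ≡⟨ cong (before +_) (∑-one (m G)) ⟩
  before + m G                                    ≤⟨ +-monoˡ-≤ (m G) before≤after ⟩
  after + m G                                     ∎)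
  where
    open ≤-Reasoning
    w : Fin n → ℕ
    w u = bit ⌊ f u ≟ i ⌋
    missing afterₖ beforeₖ : Fin (m G) → ℕ
    missing k = 1 ∸ meetSize (edgeAt G k) (part f (swap₁₂ i))
    afterₖ k = ∑[ u < n ] (w u * onEdge defect (swapAt u f) (edgeAt G k))
    beforeₖ k = ∑[ u < n ] (w u * onEdge defect f (edgeAt G k))
    after before : ℕ
    after = sum afterₖ
    before = sum beforeₖ
    before≤after : before ≤ after
    before≤after = subst₂ _≤_ (∑-weighted-comm w (λ _ k → onEdge defect f (edgeAt G k)))
                              (∑-weighted-comm w (λ u k → onEdge defect (swapAt u f) (edgeAt G k)))
                              (∑-mono-≤ (λ u → *-monoʳ-≤ (w u) (minimal u)))

hit+miss≡1 : ∀ s → bit (does (1 ≤? s)) + (1 ∸ s) ≡ 1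
hit+miss≡1 zero    = refl
hit+miss≡1 (suc s) = cong suc (0∸n≡0 s)

d+missing≡m : ∀ {n} (G : Hypergraph3 n) P → d G P + missingEdges G P ≡ m G
d+missing≡m G P = begin
  d G P + missingEdges G P       ≡⟨ cong (_+ missingEdges G P) (length-filter≡∑ _ (edges G)) ⟩
  sum hit + sum miss             ≡⟨ ∑-distrib-+ hit miss ⟨
  ∑[ k < m G ] (hit k + miss k)  ≡⟨ sum-cong-≗ (λ k → hit+miss≡1 (meetSize (edgeAt G k) P)) ⟩
  ∑[ k < m G ] 1                 ≡⟨ ∑-one (m G) ⟩
  m G                            ∎
  where
    open ≡-Reasoning
    hit miss : Fin (m G) → ℕ
    hit k = bit (does (1 ≤? meetSize (edgeAt G k) P))
    miss k = 1 ∸ meetSize (edgeAt G k) P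

3[d+M]≤5d : ∀ d M → 3 * M ≤ d + M → 3 * (d + M) ≤ 5 * d
3[d+M]≤5d d M 3M≤d+M = begin
  3 * (d + M)      ≡⟨ *-distribˡ-+ 3 d M ⟩
  3 * d + 3 * M    ≤⟨ +-monoʳ-≤ (3 * d) 3M≤d+M ⟩
  3 * d + (d + M)  ≤⟨ +-monoʳ-≤ (3 * d) (+-monoʳ-≤ d M≤d) ⟩
  3 * d + (d + d)  ≡⟨ 3*d+[d+d]≡5*d d ⟩
  5 * d            ∎
  where
    open ≤-Reasoning
    3*M≡M+M+M : ∀ M → 3 * M ≡ M + M + M
    3*M≡M+M+M = solve-∀
    3*d+[d+d]≡5*d : ∀ d → 3 * d + (d + d) ≡ 5 * d
    3*d+[d+d]≡5*d = solve-∀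
    M≤d : M ≤ d
    M≤d = ≤-trans (m≤n+m M M) (+-cancelʳ-≤ M (M + M) d (subst (_≤ d + M) (3*M≡M+M+M M) 3M≤d+M))

3*missing≤m⇒Good : ∀ {n} (G : Hypergraph3 n) P → 3 * missingEdges G P ≤ m G → Good G P
3*missing≤m⇒Good G P 3M≤m =
  subst (λ k → 3 * k ≤ 5 * d G P) d+M≡m (3[d+M]≤5d (d G P) M (subst (3 * M ≤_) (sym d+M≡m) 3M≤m))
  where
    M : ℕ
    M = missingEdges G P
    d+M≡m : d G P + M ≡ m G
    d+M≡m = d+missing≡m G P

ZeroExactlyOn : ∀ {n} → Subset n → Labelling n → Set
ZeroExactlyOn A f = ∀ v → ⌊ f v ≟ 0F ⌋ ≡ A ! v

initialLabelling : ∀ {n} → Subset n → Labelling n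
initialLabelling A v = if A ! v then 0F else 1F

initialLabelling-zero : ∀ {n} (A : Subset n) → ZeroExactlyOn A (initialLabelling A)
initialLabelling-zero A v with A ! v
... | true  = refl
... | false = refl

swap₁₂-zero : ∀ x → ⌊ swap₁₂ x ≟ 0F ⌋ ≡ ⌊ x ≟ 0F ⌋
swap₁₂-zero 0F = refl
swap₁₂-zero 1F = refl
swap₁₂-zero 2F = refl

swapAt-zero : ∀ {n} {A : Subset n} u {f : Labelling n} → ZeroExactlyOn A f → ZeroExactlyOn A (swapAt u f)
swapAt-zero u {f} zero-on v with v ≟ u
... | yes refl = trans (cong (λ x → ⌊ x ≟ 0F ⌋) (updateAt-updates v f)) (trans (swap₁₂-zero (f v)) (zero-on v))
... | no v≢u   = trans (cong (λ x → ⌊ x ≟ 0F ⌋) (updateAt-minimal v u f v≢u)) (zero-on v)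

part-zero : ∀ {n} {A : Subset n} {f : Labelling n} → ZeroExactlyOn A f → part f 0F ≡ A
part-zero {A = A} zero-on = trans (tabulate-cong zero-on) (tabulate∘lookup A)

good-tripartition : ∀ {n} (G : Hypergraph3 n) (A : Subset n) → d₂ G A ≡ 0 → Good G A → HasGoodTripartition G
good-tripartition G A d₂A≡0 A-good
  with ∃-local-min (totalDefect G) swapAt (ZeroExactlyOn A) (swapAt-zero {A = A}) (initialLabelling-zero A)
... | f , zero-on , minimal = f , good
  where
    part₀≡A : part f 0F ≡ A
    part₀≡A = part-zero zero-on
    d₂≡0 : d₂ G (part f 0F) ≡ 0
    d₂≡0 = subst (λ P → d₂ G P ≡ 0) (sym part₀≡A) d₂A≡0
    good : ∀ i → Good G (part f i)
    good 0F = subst (Good G) (sym part₀≡A) A-good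
    good 1F = 3*missing≤m⇒Good G (part f 1F) (local-min⇒3*missing≤m G f 2F (λ ()) d₂≡0 minimal)
    good 2F = 3*missing≤m⇒Good G (part f 2F) (local-min⇒3*missing≤m G f 1F (λ ()) d₂≡0 minimal)

lookup-⁅⁆ : ∀ {n} (v u : Fin n) → ⁅ v ⁆ ! u ≡ ⌊ v ≟ u ⌋
lookup-⁅⁆ zero    zero    = refl
lookup-⁅⁆ zero    (suc u) = lookup-replicate u false
lookup-⁅⁆ (suc v) zero    = refl
lookup-⁅⁆ (suc v) (suc u) = trans (lookup-⁅⁆ v u) (sym (⌊⌋-map′ _ _ (v ≟ u)))

meetSize-⁅⁆ : ∀ {n} (e : Edge n) v → meetSize e ⁅ v ⁆ ≡ bit (contains e v)
meetSize-⁅⁆ e v = trans (cong₃ (λ x y z → bit x + bit y + bit z)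
  (lookup-⁅⁆ v (v₁ e)) (lookup-⁅⁆ v (v₂ e)) (lookup-⁅⁆ v (v₃ e))) (sym (bit-contains e v))

bit≤1 : ∀ b → bit b ≤ 1
bit≤1 true  = ≤-refl
bit≤1 false = z≤n

d₂-⁅⁆ : ∀ {n} (G : Hypergraph3 n) v → d₂ G ⁅ v ⁆ ≡ 0
d₂-⁅⁆ G v = cong length (filter-none (λ e → 2 ≤? meetSize e ⁅ v ⁆)
  (universal (λ e → ≤⇒≯ (subst (_≤ 1) (sym (meetSize-⁅⁆ e v)) (bit≤1 (contains e v)))) (edges G)))

deg≡d-⁅⁆ : ∀ {n} (G : Hypergraph3 n) v → deg G v ≡ d G ⁅ v ⁆
deg≡d-⁅⁆ G v = trans (length-filter≡∑ _ (edges G))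
  (trans (sum-cong-≗ (λ k → same (edgeAt G k))) (sym (length-filter≡∑ _ (edges G))))
  where
    same : ∀ e → bit (does (contains e v ≟ᵇ true)) ≡ bit (does (1 ≤? meetSize e ⁅ v ⁆))
    same e rewrite meetSize-⁅⁆ e v with contains e v
    ... | true  = refl
    ... | false = refl

good-tripartition-of-Δ : ∀ {n} (G : Hypergraph3 n) → 3 * m G ≤ 5 * Δ G → HasGoodTripartition G
good-tripartition-of-Δ {n} G Δ-good with foldr-⊔-sel (deg G) (allFin n)
... | inj₂ (v , Δ≡deg) = good-tripartition G ⁅ v ⁆ (d₂-⁅⁆ G v)
                           (subst (λ k → 3 * m G ≤ 5 * k) (trans Δ≡deg (deg≡d-⁅⁆ G v)) Δ-good)
... | inj₁ Δ≡0 = (λ _ → 0F) , λ i → subst (λ k → 3 * k ≤ 5 * d G (part (λ _ → 0F) i)) (sym m≡0) z≤n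
  where
    m≡0 : m G ≡ 0
    m≡0 = m+n≡0⇒m≡0 (m G) (n≤0⇒n≡0 (subst (λ k → 3 * m G ≤ 5 * k) Δ≡0 Δ-good))

lemma3 : {n : ℕ} (G : Hypergraph3 n) →
         ((A : Subset n) → d₂ G A ≡ 0 → 3 * m G ≤ 5 * d G A → HasGoodTripartition G)
         × (3 * m G ≤ 5 * Δ G → HasGoodTripartition G)
lemma3 G = good-tripartition G , good-tripartition-of-Δ G
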